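{- Let $n$ be a positive integer and let $T$ be a tournament on vertex set $V=[n]$. If a vertex $v \in V$ is chosen uniformly at random, then $d^{+}(v) \geq \lfloor (n-1)/5 \rfloor$ with probability at least $3/5$.
   Context: A tournament on vertex set $V$ is a complete graph on $V$ in which every edge is given a direction. For a vertex $v$, $d^+(v)$ denotes its out-degree, i.e., the number of vertices $u \neq v$ such that the edge between $u$ and $v$ is directed $v \rightarrow u$. -}

module Defs where

open import Data.Nat using (ℕ; _∸_; _/_)
open import Data.Fin using (Fin)
open import Data.List using (List; length; filter; allFin)
open import Data.Sum using (_⊎_)
open import Data.Empty using (⊥)
open import Relation.Nullary using (¬_)
open import Relation.Binary using (Decidable)
open import Relation.Binary.PropositionalEquality using (_≡_)
open import Level using (0ℓ; suc)

record Tournament (n : ℕ) : Set₁ where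
  field
    _⇒_      : Fin n → Fin n → Set
    _⇒?_     : Decidable _⇒_
    irrefl   : ∀ v → ¬ (v ⇒ v)
    total    : ∀ u v → ¬ (u ≡ v) → (u ⇒ v) ⊎ (v ⇒ u)
    antisym  : ∀ u v → u ⇒ v → v ⇒ u → ⊥

-- out-degree d⁺(v): number of vertices u with v → u
-- (u ≠ v is automatic by irreflexivity)
outDeg : ∀ {n} → Tournament n → Fin n → ℕ
outDeg T v = length (filter (λ u → v ⇒? u) (allFin _))
  where open Tournament T

-- Let L be the set of vertices of out-degree below k = ⌊(n-1)/5⌋.  The
-- subtournament on L has ℓ(ℓ-1)/2 edges, each counted in the out-degree of
-- one vertex of L, while each such out-degree is at most k - 1; hence
-- ℓ(ℓ-1)/2 ≤ ℓ(k-1), i.e. ℓ ≤ 2k.  As 5k ≤ n - 1, at most 2n/5 vertices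
-- lie in L.
module Submission where

open import Defs
open import Data.Nat using (ℕ; suc; zero; _+_; _*_; _≤_; _<_; _∸_; _/_; _≥?_; z≤n)
open import Data.Nat.Properties
open import Data.Nat.DivMod using (m/n*n≤m)
open import Data.Nat.ListAction using (sum)
open import Data.Nat.Tactic.RingSolver using (solve-∀)
open import Algebra.Properties.CommutativeSemigroup +-commutativeSemigroup
  using (x∙yz≈y∙xz)
open import Data.Fin using (Fin)
open import Data.List using (List; []; _∷_; length; map; filter; allFin)
open import Data.List.Properties using (length-tabulate)
open import Data.List.Relation.Unary.All as All using (All; []; _∷_)
open import Data.List.Relation.Unary.All.Properties using (all-filter)
open import Data.List.Relation.Unary.AllPairs using (_∷_)
open import Data.List.Relation.Unary.Unique.Propositional using (Unique)
import Data.List.Relation.Unary.Unique.Propositional.Properties as Unique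
open import Data.List.Relation.Binary.Sublist.Propositional using (_⊆_)
open import Data.List.Relation.Binary.Sublist.Propositional.Properties
  using (length-mono-≤; filter-⊆; filter⁺)
open import Data.Sum using (inj₁; inj₂)
open import Data.Empty using (⊥-elim)
open import Relation.Nullary using (yes; no)
open import Relation.Unary using (Pred; Decidable)
open import Relation.Unary.Properties using (∁?)
open import Relation.Binary.PropositionalEquality

module _ {A : Set} {p} {P : Pred A p} (P? : Decidable P) where

  length-filter+filter∁ : ∀ xs → length (filter P? xs) + length (filter (∁? P?) xs) ≡ length xs
  length-filter+filter∁ [] = refl
  length-filter+filter∁ (x ∷ xs) with P? x
  ... | yes _ = cong suc (length-filter+filter∁ xs)
  ... | no _  = trans (+-suc _ _) (cong suc (length-filter+filter∁ xs))

module _ {A : Set} (f : A → ℕ) {k : ℕ} where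

  All<⇒length+sum≤length* : ∀ {xs} → All (λ x → f x < k) xs → length xs + sum (map f xs) ≤ length xs * k
  All<⇒length+sum≤length* [] = z≤n
  All<⇒length+sum≤length* {x ∷ xs} (fx<k ∷ fxs<k) = begin
    suc (length xs) + (f x + sum (map f xs))   ≡⟨ cong suc (x∙yz≈y∙xz (length xs) (f x) _) ⟩
    suc (f x) + (length xs + sum (map f xs))   ≤⟨ +-mono-≤ fx<k (All<⇒length+sum≤length* fxs<k) ⟩
    k + length xs * k                          ∎
    where open ≤-Reasoning

m*m≤m*n⇒m≤n : ∀ m n → m * m ≤ m * n → m ≤ n
m*m≤m*n⇒m≤n zero    n _  = z≤n
m*m≤m*n⇒m≤n (suc m) n le = *-cancelˡ-≤ (suc m) le

module _ {n : ℕ} (T : Tournament n) where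
  open Tournament T

  outDegIn : List (Fin n) → Fin n → ℕ
  outDegIn S v = length (filter (v ⇒?_) S)

  inDegIn : List (Fin n) → Fin n → ℕ
  inDegIn S v = length (filter (_⇒? v) S)

  edgesIn : List (Fin n) → ℕ
  edgesIn S = sum (map (outDegIn S) S)

  outDegIn-mono : ∀ {S R} v → S ⊆ R → outDegIn S v ≤ outDegIn R v
  outDegIn-mono v S⊆R = length-mono-≤ (filter⁺ (v ⇒?_) (v ⇒?_) (λ { refl p → p }) S⊆R)

  outDegIn+inDegIn≡length : ∀ {v} S → All (v ≢_) S → outDegIn S v + inDegIn S v ≡ length S
  outDegIn+inDegIn≡length [] [] = refl
  outDegIn+inDegIn≡length {v} (u ∷ S) (v≢u ∷ v≢S) with v ⇒? u | u ⇒? v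
  ... | yes v⇒u | yes u⇒v = ⊥-elim (antisym v u v⇒u u⇒v)
  ... | yes _   | no _    = cong suc (outDegIn+inDegIn≡length S v≢S)
  ... | no _    | yes _   = trans (+-suc _ _) (cong suc (outDegIn+inDegIn≡length S v≢S))
  ... | no v⇏u  | no u⇏v with total v u v≢u
  ...   | inj₁ v⇒u = ⊥-elim (v⇏u v⇒u)
  ...   | inj₂ u⇒v = ⊥-elim (u⇏v u⇒v)

  sum-outDegIn-∷ : ∀ x R S → sum (map (outDegIn (x ∷ R)) S) ≡ inDegIn S x + sum (map (outDegIn R) S)
  sum-outDegIn-∷ x R [] = refl
  sum-outDegIn-∷ x R (u ∷ S) rewrite sum-outDegIn-∷ x R S with u ⇒? x
  ... | yes _ = cong suc (x∙yz≈y∙xz (outDegIn R u) (inDegIn S x) _)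
  ... | no _  = x∙yz≈y∙xz (outDegIn R u) (inDegIn S x) _

  edgesIn-∷ : ∀ {x} S → All (x ≢_) S → edgesIn (x ∷ S) ≡ length S + edgesIn S
  edgesIn-∷ {x} S x≢S with x ⇒? x
  ... | yes x⇒x = ⊥-elim (irrefl x x⇒x)
  ... | no _    = begin
    outDegIn S x + sum (map (outDegIn (x ∷ S)) S)  ≡⟨ cong (outDegIn S x +_) (sum-outDegIn-∷ x S S) ⟩
    outDegIn S x + (inDegIn S x + edgesIn S)       ≡⟨ +-assoc (outDegIn S x) _ _ ⟨
    outDegIn S x + inDegIn S x + edgesIn S         ≡⟨ cong (_+ edgesIn S) (outDegIn+inDegIn≡length S x≢S) ⟩
    length S + edgesIn S                           ∎
    where open ≡-Reasoning

  2*edgesIn+length≡length² : ∀ S → Unique S → 2 * edgesIn S + length S ≡ length S * length S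
  2*edgesIn+length≡length² []      _           = refl
  2*edgesIn+length≡length² (x ∷ S) (x≢S ∷ uS) = begin
    2 * edgesIn (x ∷ S) + suc l       ≡⟨ cong (λ e → 2 * e + suc l) (edgesIn-∷ S x≢S) ⟩
    2 * (l + edgesIn S) + suc l       ≡⟨ regroup l (edgesIn S) ⟩
    (2 * edgesIn S + l) + suc (2 * l) ≡⟨ cong (_+ suc (2 * l)) (2*edgesIn+length≡length² S uS) ⟩
    l * l + suc (2 * l)               ≡⟨ square-suc l ⟩
    suc l * suc l                     ∎
    where
      open ≡-Reasoning
      l = length S
      regroup : ∀ l e → 2 * (l + e) + suc l ≡ (2 * e + l) + suc (2 * l)
      regroup = solve-∀
      square-suc : ∀ l → l * l + suc (2 * l) ≡ suc l * suc l
      square-suc = solve-∀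

  outDegIn<⇒length≤2* : ∀ {k} S → Unique S → All (λ v → outDegIn S v < k) S → length S ≤ 2 * k
  outDegIn<⇒length≤2* {k} S uS outDeg<k = m*m≤m*n⇒m≤n l (2 * k) (begin
    l * l                 ≡⟨ 2*edgesIn+length≡length² S uS ⟨
    2 * edgesIn S + l     ≤⟨ m≤m+n _ l ⟩
    2 * edgesIn S + l + l ≡⟨ regroup (edgesIn S) l ⟩
    2 * (l + edgesIn S)   ≤⟨ *-monoʳ-≤ 2 (All<⇒length+sum≤length* (outDegIn S) outDeg<k) ⟩
    2 * (l * k)           ≡⟨ *-swap 2 l k ⟩
    l * (2 * k)           ∎)
    where
      open ≤-Reasoning
      l = length S
      regroup : ∀ e l → 2 * e + l + l ≡ 2 * (l + e)
      regroup = solve-∀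
      *-swap : ∀ a b c → a * (b * c) ≡ b * (a * c)
      *-swap = solve-∀

lowOutDeg-count≤2* : ∀ {n} (T : Tournament n) k →
  length (filter (∁? (λ v → outDeg T v ≥? k)) (allFin n)) ≤ 2 * k
-- outDeg T is definitionally outDegIn T (allFin n).
lowOutDeg-count≤2* {n} T k = outDegIn<⇒length≤2* T L
  (Unique.filter⁺ low? (Unique.allFin⁺ n))
  (All.map (λ {v} outDeg≱k → ≤-<-trans (outDegIn-mono T v (filter-⊆ low? (allFin n))) (≰⇒> outDeg≱k))
           (all-filter low? (allFin n)))
  where
    low? = ∁? (λ v → outDeg T v ≥? k)
    L = filter low? (allFin n)

mainTheorem1 : (m : ℕ) → (T : Tournament (suc m)) →
    3 * suc m ≤ 5 * length (filter (λ v → outDeg T v ≥? ((suc m ∸ 1) / 5)) (allFin (suc m)))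
mainTheorem1 m T = +-cancelʳ-≤ (5 * ℓ) (3 * suc m) (5 * g) (begin
    3 * suc m + 5 * ℓ      ≤⟨ +-monoʳ-≤ (3 * suc m) 5ℓ≤2n ⟩
    3 * suc m + 2 * suc m  ≡⟨ *-distribʳ-+ (suc m) 3 2 ⟨
    5 * suc m              ≡⟨ cong (5 *_) g+ℓ≡n ⟨
    5 * (g + ℓ)            ≡⟨ *-distribˡ-+ 5 g ℓ ⟩
    5 * g + 5 * ℓ          ∎)
  where
    open ≤-Reasoning
    k = m / 5
    high? = λ v → outDeg T v ≥? k
    g = length (filter high? (allFin (suc m)))
    ℓ = length (filter (∁? high?) (allFin (suc m)))
    g+ℓ≡n : g + ℓ ≡ suc m
    g+ℓ≡n = trans (length-filter+filter∁ high? (allFin (suc m))) (length-tabulate (λ v → v))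
    regroup : ∀ k → 5 * (2 * k) ≡ 2 * (k * 5)
    regroup = solve-∀
    5ℓ≤2n : 5 * ℓ ≤ 2 * suc m
    5ℓ≤2n = begin
      5 * ℓ        ≤⟨ *-monoʳ-≤ 5 (lowOutDeg-count≤2* T k) ⟩
      5 * (2 * k)  ≡⟨ regroup k ⟩
      2 * (k * 5)  ≤⟨ *-monoʳ-≤ 2 (≤-trans (m/n*n≤m m 5) (n≤1+n m)) ⟩
      2 * suc m    ∎
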